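{- The skeleton $T$ is leaf-recursive: deleting all leaves of $T$ (so that every remaining node drops one level) yields a tree isomorphic to $T$ as an ordered tree, with the $(i+1)$-st supernode becoming the $i$-th supernode and the former first supernode becoming the leftmost leaf.
   Context: Fix nonnegative integers $\lambda_1,\lambda_2,\dots$ and an integer $k\ge1$ (the order) such that $\lambda_1\ge1$, $\lambda_k\ge1$, $\lambda_i=0$ for all $i>k$, and $\lambda_1\ge2$ if $k=1$. For $j\ge0$ let $\Lambda_j=\sum_{i=1}^j\lambda_i$ and $\Lambda=\Lambda_k$. All trees are ordered (children ordered left to right). Define finite trees $T_j$: $T_0$ is a single node. For $j\ge1$, $T_j$ has a chain of special nodes $s_j$ (root), $s_{j-1},\dots,s_0$ with $s_i$ on level $i$ and $s_{i-1}$ the leftmost child of $s_i$; for $1\le i\le j$, $s_i$ has $\Lambda_{j-i+1}$ children: $s_{i-1}$ followed by $\Lambda_{j-i+1}-1$ roots of copies of $T_{i-1}$. The skeleton $T$ is the infinite rootless tree with special nodes $u_0,u_1,\dots$, where $u_0$ is a leaf on level $0$, $u_{i-1}$ is the leftmost child of $u_i$, and for $i\ge1$ the $i$-th supernode $u_i$ (on level $i$) has, to the right of $u_{i-1}$, exactly $\Lambda-1$ further children, each the root of a copy of $T_{i-1}$. -}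

module Defs where

open import Data.Nat using (ℕ; zero; suc; _+_; _∸_)
open import Data.List using (List; []; _∷_; replicate)
open import Data.Maybe using (Maybe; just; nothing)

data Tree : Set where
  node : List Tree → Tree

leaf : Tree
leaf = node []

pruneList : List Tree → List Tree
pruneList [] = []
pruneList (node [] ∷ ts) = pruneList ts
pruneList (node (c ∷ cs) ∷ ts) = node (pruneList (c ∷ cs)) ∷ pruneList ts

deleteLeaves : Tree → Maybe Tree
deleteLeaves (node []) = nothing
deleteLeaves (node (c ∷ cs)) = just (node (pruneList (c ∷ cs)))

-- The parameter sequence λ is a function lam : ℕ → ℕ, with λ_i = lam i
-- for i ≥ 1 (lam 0 is unused).
-- Λ_j = Σ_{i=1}^{j} λ_i
Λ[_] : (ℕ → ℕ) → ℕ → ℕ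
Λ[ lam ] zero = 0
Λ[ lam ] (suc j) = Λ[ lam ] j + lam (suc j)

mutual
  -- chain lam j i : the subtree of T_j rooted at the special node s_i (i ≤ j).
  -- s_0 is a leaf; s_{i+1} has Λ_{j-(i+1)+1} = Λ_{j-i} children:
  -- s_i followed by Λ_{j-i} - 1 copies of T_i.
  chain : (ℕ → ℕ) → ℕ → ℕ → Tree
  chain lam j zero = leaf
  chain lam j (suc i) =
    node (chain lam j i ∷ replicate (Λ[ lam ] (j ∸ i) ∸ 1) (Tr lam i))

  Tr : (ℕ → ℕ) → ℕ → Tree
  Tr lam j = chain lam j j

-- The skeleton T (of order k, so Λ = Λ_k), represented through the subtrees
-- S i rooted at its supernodes u_i: u_0 is a leaf, and u_{i+1} has children
-- u_i followed by Λ - 1 copies of T_i.  T is the union of the chain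
-- S 0 ⊂ S 1 ⊂ S 2 ⊂ ... (S i being the leftmost child subtree of S (i+1)).
Sk : (ℕ → ℕ) → ℕ → ℕ → Tree
Sk lam k zero = leaf
Sk lam k (suc i) = node (Sk lam k i ∷ replicate (Λ[ lam ] k ∸ 1) (Tr lam i))

module Submission where

open import Defs
open import Data.Nat using (ℕ; zero; suc; _∸_; _≥_; _>_)
open import Data.List using ([]; _∷_; replicate)
open import Data.Maybe using (just)
open import Relation.Binary.PropositionalEquality using (_≡_; refl; cong; trans)

-- Every node of T_j and of the skeleton has a special first child followed by
-- copies of one tree T_i.  Deleting leaves acts on such a node child by child,
-- so it shifts the node one level down as soon as it shifts the special child
-- and T_i; for T_i this is the same statement one index lower.  The child
-- counts match because s_{i+1} in T_{j+1} and s_i in T_j both have Λ_{j-i+1}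
-- children, and every supernode has the same number Λ of children.

pruneList-∷ : ∀ {t t′} ts → deleteLeaves t ≡ just t′ → pruneList (t ∷ ts) ≡ t′ ∷ pruneList ts
pruneList-∷ {node (_ ∷ _)} ts refl = refl

pruneList-replicate : ∀ {t t′} n → deleteLeaves t ≡ just t′
                      → pruneList (replicate n t) ≡ replicate n t′
pruneList-replicate zero    _  = refl
pruneList-replicate (suc n) eq =
  trans (pruneList-∷ (replicate n _) eq) (cong (_ ∷_) (pruneList-replicate n eq))

pruneList-replicate-leaf : ∀ n → pruneList (replicate n leaf) ≡ []
pruneList-replicate-leaf zero    = refl
pruneList-replicate-leaf (suc n) = pruneList-replicate-leaf n

deleteLeaves-leaf-fan : ∀ n → deleteLeaves (node (leaf ∷ replicate n leaf)) ≡ just leaf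
deleteLeaves-leaf-fan n = cong (λ ts → just (node ts)) (pruneList-replicate-leaf n)

deleteLeaves-fan : ∀ {s′ t′} s t n → deleteLeaves s ≡ just s′ → deleteLeaves t ≡ just t′
                   → deleteLeaves (node (s ∷ replicate n t)) ≡ just (node (s′ ∷ replicate n t′))
deleteLeaves-fan _ _ n s↓ t↓ =
  cong (λ ts → just (node ts))
       (trans (pruneList-∷ (replicate n _) s↓) (cong (_ ∷_) (pruneList-replicate n t↓)))

deleteLeaves-chain : ∀ lam j i → deleteLeaves (chain lam (suc j) (suc i)) ≡ just (chain lam j i)
deleteLeaves-chain lam j zero    = deleteLeaves-leaf-fan (Λ[ lam ] (suc j) ∸ 1)
deleteLeaves-chain lam j (suc i) =
  deleteLeaves-fan (chain lam (suc j) (suc i)) (Tr lam (suc i)) (Λ[ lam ] (j ∸ i) ∸ 1)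
    (deleteLeaves-chain lam j i) (deleteLeaves-chain lam i i)

deleteLeaves-Tr : ∀ lam j → deleteLeaves (Tr lam (suc j)) ≡ just (Tr lam j)
deleteLeaves-Tr lam j = deleteLeaves-chain lam j j

deleteLeaves-Sk : ∀ lam k i → deleteLeaves (Sk lam k (suc i)) ≡ just (Sk lam k i)
deleteLeaves-Sk lam k zero    = deleteLeaves-leaf-fan (Λ[ lam ] k ∸ 1)
deleteLeaves-Sk lam k (suc i) =
  deleteLeaves-fan (Sk lam k (suc i)) (Tr lam (suc i)) (Λ[ lam ] k ∸ 1)
    (deleteLeaves-Sk lam k i) (deleteLeaves-Tr lam i)

proposition2p6 : (lam : ℕ → ℕ) (k : ℕ) → k ≥ 1 → lam 1 ≥ 1 → lam k ≥ 1
                 → (∀ i → i > k → lam i ≡ 0) → (k ≡ 1 → lam 1 ≥ 2)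
                 → ∀ i → deleteLeaves (Sk lam k (suc i)) ≡ just (Sk lam k i)
proposition2p6 lam k _ _ _ _ _ = deleteLeaves-Sk lam k
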